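{- Let $n\ge 1$ and $A\subseteq V(T_n)$. (i) If no vertex $x$ with $|x|=n$ belongs to $A$, then $|N(A)|\ge |N(C)|$, where $C$ is the initial segment of the simplicial ordering of size $|A|$. (ii) If every vertex $x$ with $|x|=n$ belongs to $A$, then $|N(A)|\ge |N(D)|$, where $D$ is the final segment of the simplicial ordering of size $|A|$.
   Context: The triangular grid graph $T_n$ has vertex set $\{(v_1,v_2)\in\mathbb{Z}_{\ge 0}^2 : v_1+v_2\le n\}$, and two vertices are adjacent iff they are of the form $(a,b),(a+1,b)$, or $(a,b),(a,b+1)$, or $(a+1,b),(a,b+1)$. For a vertex $v=(v_1,v_2)$, $|v|=v_1+v_2$. For $S\subseteq V(T_n)$, $\partial_{T_n}(S)$ is the set of vertices not in $S$ adjacent to some vertex of $S$, and $N(S)=S\cup\partial_{T_n}(S)$. The simplicial ordering on $V(T_n)$: $u$ comes before $v$ iff $|u|<|v|$, or $|u|=|v|$ and $u_1>v_1$. The initial (resp. final) segment of size $m$ is the set of the first (resp. last) $m$ vertices in this ordering. -}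

module Defs where

open import Data.Nat using (ℕ; zero; suc; _+_; _∸_; _≡ᵇ_)
open import Data.Bool using (Bool; true; false; _∧_; _∨_; not)
open import Data.Product using (_×_; _,_; proj₁; proj₂)
open import Data.List using (List; []; _∷_; _++_; length; filter; take; drop; concatMap; map)
open import Data.Bool.ListAction using (any)
open import Data.List.Base using (upTo)
open import Data.Bool.Properties using (T?)

-- Vertices of T_n are pairs (v₁ , v₂) of naturals with v₁ + v₂ ≤ n.
Vertex : Set
Vertex = ℕ × ℕ

∣_∣ᵥ : Vertex → ℕ
∣ (a , b) ∣ᵥ = a + b

-- Subsets of V(T_n) are given by Boolean indicator functions;
-- only their values on V(T_n) matter.
VSet : Set
VSet = Vertex → Bool

level : ℕ → List Vertex
level k = map (λ i → (k ∸ i , i)) (upTo (suc k))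

-- V(T_n) listed in the simplicial ordering
verts : ℕ → List Vertex
verts n = concatMap level (upTo (suc n))

eqV : Vertex → Vertex → Bool
eqV (a , b) (c , d) = (a ≡ᵇ c) ∧ (b ≡ᵇ d)

edge : Vertex → Vertex → Bool
edge (a , b) (c , d) =
  ((c ≡ᵇ suc a) ∧ (d ≡ᵇ b)) ∨ ((c ≡ᵇ a) ∧ (d ≡ᵇ suc b)) ∨ ((a ≡ᵇ suc c) ∧ (d ≡ᵇ suc b))

adj : Vertex → Vertex → Bool
adj u v = edge u v ∨ edge v u

card : ℕ → VSet → ℕ
card n S = length (filter (λ v → T? (S v)) (verts n))

nbhd : ℕ → VSet → VSet
nbhd n S v = S v ∨ any (λ u → S u ∧ adj u v) (verts n)

fromList : List Vertex → VSet
fromList L v = any (λ u → eqV u v) L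

initSeg : ℕ → ℕ → VSet
initSeg n m = fromList (take m (verts n))

finalSeg : ℕ → ℕ → VSet
finalSeg n m = fromList (drop (length (verts n) ∸ m) (verts n))

-- Rank the vertices by the simplicial ordering: rank (a , b) = C₂ (a + b + 1) + b, so initial and
-- final segments are rank intervals, and a neighbour of u has rank within ∣ u ∣ᵥ + 2 of rank u.
-- Let d = |∂A|. In case (i), walking up a column from a vertex of A in row b leaves A through a
-- boundary vertex in a higher row, and walking along row b leaves it through a boundary vertex
-- in row b. So the row-b part of A injects into the boundary above row b, and is empty unless row b
-- meets ∂A; downward induction on b gives |A| ≤ C₂ d. In case (ii) the same walks, now entering A,
-- give |V ∖ A| ≤ C₂ (d + 1). These bounds say precisely that N(C) has ranks below |A| + d, and N(D)
-- ranks at least |V| − |A| − d, so both have at most |A| + d = |N(A)| elements.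

module Submission where

open import Defs
open import Data.Bool using (Bool; true; false; _∧_; _∨_; not)
open import Data.Bool.ListAction using (any)
open import Data.Bool.Properties using (T?; T-≡; ∧-conicalˡ; ∧-conicalʳ; ∨-comm; ∨-zeroʳ; not-involutive)
open import Data.List using (List; []; _∷_; _++_; length; filter; take; drop; concatMap; map; applyUpTo; upTo)
open import Data.List.Membership.Propositional using (_∈_; lose; find)
open import Data.List.Membership.Propositional.Properties using (∈-map⁺; ∈-upTo⁺; ∈-upTo⁻; ∈-applyUpTo⁻; ∈-concatMap⁺)
open import Data.List.Properties
  using (map-++; concatMap-++; ++-identityʳ; length-map; map-∘; map-upTo; upTo-∷ʳ; length-upTo; take-map; drop-map)
open import Data.List.Relation.Unary.Any using (here; there)
open import Data.List.Relation.Unary.Any.Properties using (any⁺; any⁻)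
open import Data.Nat using (ℕ; zero; suc; _+_; _*_; _∸_; _≤_; _<_; _≥_; z≤n; s≤s; _⊓_; _≡ᵇ_; _≟_; _≤?_)
open import Data.Nat.Properties
open import Algebra.Properties.CommutativeSemigroup +-commutativeSemigroup using (interchange; x∙yz≈y∙xz)
open import Data.Nat.Tactic.RingSolver using (solve-∀)
open import Data.Product using (_×_; _,_; ∃; proj₁; proj₂)
open import Data.Sum using (_⊎_; inj₁; inj₂)
open import Function.Bundles using (Equivalence)
open import Relation.Binary.PropositionalEquality
open import Relation.Nullary using (yes; no; contradiction)

private variable
  X Y : Set

∑ : List X → (X → ℕ) → ℕ
∑ []       f = 0
∑ (x ∷ xs) f = f x + ∑ xs f

∑-map : ∀ (g : X → Y) xs (f : Y → ℕ) → ∑ (map g xs) f ≡ ∑ xs (λ x → f (g x))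
∑-map g []       f = refl
∑-map g (x ∷ xs) f = cong (f (g x) +_) (∑-map g xs f)

∑-cong : ∀ xs {f g : X → ℕ} → (∀ x → x ∈ xs → f x ≡ g x) → ∑ xs f ≡ ∑ xs g
∑-cong []       eq = refl
∑-cong (x ∷ xs) eq = cong₂ _+_ (eq x (here refl)) (∑-cong xs (λ y y∈xs → eq y (there y∈xs)))

∑-mono-≤ : ∀ xs {f g : X → ℕ} → (∀ x → x ∈ xs → f x ≤ g x) → ∑ xs f ≤ ∑ xs g
∑-mono-≤ []       le = z≤n
∑-mono-≤ (x ∷ xs) le = +-mono-≤ (le x (here refl)) (∑-mono-≤ xs (λ y y∈xs → le y (there y∈xs)))

∑-zero : ∀ xs {f : X → ℕ} → (∀ x → x ∈ xs → f x ≡ 0) → ∑ xs f ≡ 0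
∑-zero xs eq = trans (∑-cong xs eq) (∑-0 xs)
  where
  ∑-0 : ∀ (xs : List X) → ∑ xs (λ _ → 0) ≡ 0
  ∑-0 []       = refl
  ∑-0 (x ∷ xs) = ∑-0 xs

∑-+ : ∀ xs (f g : X → ℕ) → ∑ xs (λ x → f x + g x) ≡ ∑ xs f + ∑ xs g
∑-+ []       f g = refl
∑-+ (x ∷ xs) f g = trans (cong (f x + g x +_) (∑-+ xs f g)) (interchange (f x) (g x) (∑ xs f) (∑ xs g))

∑-swap : ∀ xs (ys : List Y) (f : X → Y → ℕ) → ∑ xs (λ x → ∑ ys (f x)) ≡ ∑ ys (λ y → ∑ xs (λ x → f x y))
∑-swap []       ys f = sym (∑-zero ys (λ _ _ → refl))
∑-swap (x ∷ xs) ys f = trans (cong (∑ ys (f x) +_) (∑-swap xs ys f)) (sym (∑-+ ys (f x) _))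

∑-const1 : ∀ (xs : List X) → ∑ xs (λ _ → 1) ≡ length xs
∑-const1 []       = refl
∑-const1 (x ∷ xs) = cong suc (∑-const1 xs)

∈⇒≤∑ : ∀ {xs x} (f : X → ℕ) → x ∈ xs → f x ≤ ∑ xs f
∈⇒≤∑ {xs = y ∷ xs} f (here refl) = m≤m+n (f y) (∑ xs f)
∈⇒≤∑ {xs = y ∷ xs} f (there x∈xs) = ≤-trans (∈⇒≤∑ f x∈xs) (m≤n+m (∑ xs f) (f y))

∑-positive : ∀ xs (f : X → ℕ) → 1 ≤ ∑ xs f → ∃ λ x → x ∈ xs × 1 ≤ f x
∑-positive (x ∷ xs) f pos with f x in eq
... | suc k = x , here refl , subst (1 ≤_) (sym eq) (s≤s z≤n)
... | zero with ∑-positive xs f pos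
...   | y , y∈xs , fy = y , there y∈xs , fy

⟦_⟧ : Bool → ℕ
⟦ true  ⟧ = 1
⟦ false ⟧ = 0

⟦⟧≤1 : ∀ b → ⟦ b ⟧ ≤ 1
⟦⟧≤1 true  = ≤-refl
⟦⟧≤1 false = z≤n

length-filter : ∀ xs (S : X → Bool) → length (filter (λ x → T? (S x)) xs) ≡ ∑ xs (λ x → ⟦ S x ⟧)
length-filter []       S = refl
length-filter (x ∷ xs) S with S x
... | true  = cong suc (length-filter xs S)
... | false = length-filter xs S

≡ᵇ-refl : ∀ m → (m ≡ᵇ m) ≡ true
≡ᵇ-refl zero    = refl
≡ᵇ-refl (suc m) = ≡ᵇ-refl m

∨-≡true : ∀ x {y} → x ∨ y ≡ true → x ≡ true ⊎ y ≡ true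
∨-≡true true  _   = inj₁ refl
∨-≡true false y≡t = inj₂ y≡t

≡ᵇ∧≡ᵇ : ∀ m n k l → (m ≡ᵇ n) ∧ (k ≡ᵇ l) ≡ true → m ≡ n × k ≡ l
≡ᵇ∧≡ᵇ m n k l eq =
  ≡ᵇ⇒≡ m n (Equivalence.from T-≡ (∧-conicalˡ _ _ eq)) , ≡ᵇ⇒≡ k l (Equivalence.from T-≡ (∧-conicalʳ _ _ eq))

any-≡true⁻ : ∀ (p : X → Bool) xs → any p xs ≡ true → ∃ λ x → x ∈ xs × p x ≡ true
any-≡true⁻ p xs eq with x , x∈xs , px ← find (any⁻ p xs (Equivalence.from T-≡ eq)) = x , x∈xs , Equivalence.to T-≡ px

any-≡true⁺ : ∀ (p : X → Bool) {xs x} → x ∈ xs → p x ≡ true → any p xs ≡ true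
any-≡true⁺ p x∈xs px = Equivalence.to T-≡ (any⁺ p (lose x∈xs (Equivalence.from T-≡ px)))

δ : ℕ → ℕ → ℕ
δ zero    zero    = 1
δ zero    (suc n) = 0
δ (suc m) zero    = 0
δ (suc m) (suc n) = δ m n

θ : ℕ → ℕ → ℕ
θ zero    n       = 1
θ (suc m) zero    = 0
θ (suc m) (suc n) = θ m n

δ-refl : ∀ m → δ m m ≡ 1
δ-refl zero    = refl
δ-refl (suc m) = δ-refl m

δ-sym : ∀ m n → δ m n ≡ δ n m
δ-sym zero    zero    = refl
δ-sym zero    (suc n) = refl
δ-sym (suc m) zero    = refl
δ-sym (suc m) (suc n) = δ-sym m n

δ-≢ : ∀ {m n} → m ≢ n → δ m n ≡ 0
δ-≢ {zero}  {zero}  m≢n = contradiction refl m≢n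
δ-≢ {zero}  {suc n} _   = refl
δ-≢ {suc m} {zero}  _   = refl
δ-≢ {suc m} {suc n} m≢n = δ-≢ (λ m≡n → m≢n (cong suc m≡n))

δ-case : ∀ m n → m ≡ n ⊎ δ m n ≡ 0
δ-case m n with m ≟ n
... | yes m≡n = inj₁ m≡n
... | no  m≢n = inj₂ (δ-≢ m≢n)

θ-≤ : ∀ {m n} → m ≤ n → θ m n ≡ 1
θ-≤ {zero}  _         = refl
θ-≤ {suc m} (s≤s m≤n) = θ-≤ m≤n

θ-> : ∀ {m n} → n < m → θ m n ≡ 0
θ-> {suc m} {zero}  _         = refl
θ-> {suc m} {suc n} (s≤s n<m) = θ-> n<m

θ-split : ∀ m n → θ m n ≡ δ n m + θ (suc m) n
θ-split zero    zero    = refl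
θ-split zero    (suc n) = refl
θ-split (suc m) zero    = refl
θ-split (suc m) (suc n) = θ-split m n

∑-upTo-suc : ∀ k (f : ℕ → ℕ) → ∑ (upTo (suc k)) f ≡ f 0 + ∑ (upTo k) (λ i → f (suc i))
∑-upTo-suc k f = cong (f 0 +_) (trans (cong (λ xs → ∑ xs f) (sym (map-upTo suc k))) (∑-map suc (upTo k) f))

∑-δ : ∀ {k c} (h : ℕ → ℕ) → c < k → ∑ (upTo k) (λ i → δ i c * h i) ≡ h c
∑-δ {suc k} {zero} h _ = begin
  ∑ (upTo (suc k)) (λ i → δ i 0 * h i)       ≡⟨ ∑-upTo-suc k (λ i → δ i 0 * h i) ⟩
  h 0 + 0 + ∑ (upTo k) (λ i → 0)             ≡⟨ cong₂ _+_ (+-identityʳ (h 0)) (∑-zero (upTo k) (λ _ _ → refl)) ⟩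
  h 0 + 0                                    ≡⟨ +-identityʳ (h 0) ⟩
  h 0                                        ∎
  where open ≡-Reasoning
∑-δ {suc k} {suc c} h (s≤s c<k) = trans (∑-upTo-suc k (λ i → δ i (suc c) * h i)) (∑-δ (λ i → h (suc i)) c<k)

∑-δ≤1 : ∀ k c → ∑ (upTo k) (λ i → δ i c) ≤ 1
∑-δ≤1 zero    c       = z≤n
∑-δ≤1 (suc k) zero    = ≤-reflexive (trans (∑-upTo-suc k (λ i → δ i 0)) (cong suc (∑-zero (upTo k) (λ _ _ → refl))))
∑-δ≤1 (suc k) (suc c) = ≤-trans (≤-reflexive (∑-upTo-suc k (λ i → δ i (suc c)))) (∑-δ≤1 k c)

∑-θ-below : ∀ k x → ∑ (upTo k) (λ i → θ (suc i) x) ≤ x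
∑-θ-below zero    x       = z≤n
∑-θ-below (suc k) zero    = ≤-reflexive (trans (∑-upTo-suc k (λ i → θ (suc i) 0)) (∑-zero (upTo k) (λ _ _ → refl)))
∑-θ-below (suc k) (suc x) = ≤-trans (≤-reflexive (∑-upTo-suc k (λ i → θ (suc i) (suc x)))) (s≤s (∑-θ-below k x))

∑-θ-above : ∀ k y → ∑ (upTo k) (θ y) ≤ k ∸ y
∑-θ-above k       zero    = ≤-reflexive (trans (∑-const1 (upTo k)) (length-upTo k))
∑-θ-above zero    (suc y) = z≤n
∑-θ-above (suc k) (suc y) = ≤-trans (≤-reflexive (∑-upTo-suc k (θ (suc y)))) (∑-θ-above k y)

C₂ : ℕ → ℕ
C₂ zero    = 0
C₂ (suc k) = k + C₂ k

C₂-mono-≤ : ∀ {a b} → a ≤ b → C₂ a ≤ C₂ b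
C₂-mono-≤ {zero}              _         = z≤n
C₂-mono-≤ {suc a} {suc b} (s≤s a≤b) = +-mono-≤ a≤b (C₂-mono-≤ a≤b)

C₂-cancel-< : ∀ {a b} → C₂ a < C₂ b → a < b
C₂-cancel-< lt = ≰⇒> (λ b≤a → <⇒≱ lt (C₂-mono-≤ b≤a))

m∸[m∸n]≤n : ∀ m n → m ∸ (m ∸ n) ≤ n
m∸[m∸n]≤n m n with n ≤? m
... | yes n≤m = ≤-reflexive (m∸[m∸n]≡n n≤m)
... | no  n≰m = ≤-trans (m∸n≤m m (m ∸ n)) (<⇒≤ (≰⇒> n≰m))

applyUpTo-cong : ∀ {f g : ℕ → X} k → (∀ i → i < k → f i ≡ g i) → applyUpTo f k ≡ applyUpTo g k
applyUpTo-cong zero    eq = refl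
applyUpTo-cong (suc k) eq = cong₂ _∷_ (eq 0 (s≤s z≤n)) (applyUpTo-cong k (λ i i<k → eq (suc i) (s≤s i<k)))

upTo-+ : ∀ a b → upTo (a + b) ≡ upTo a ++ applyUpTo (a +_) b
upTo-+ a b = go a (λ i → i)
  where
  go : ∀ a (f : ℕ → ℕ) → applyUpTo f (a + b) ≡ applyUpTo f a ++ applyUpTo (λ i → f (a + i)) b
  go zero    f = refl
  go (suc a) f = cong (f 0 ∷_) (go a (λ i → f (suc i)))

take-applyUpTo : ∀ m k (f : ℕ → X) → take m (applyUpTo f k) ≡ applyUpTo f (m ⊓ k)
take-applyUpTo zero    k       f = refl
take-applyUpTo (suc m) zero    f = refl
take-applyUpTo (suc m) (suc k) f = cong (f 0 ∷_) (take-applyUpTo m k (λ i → f (suc i)))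

drop-applyUpTo : ∀ m k (f : ℕ → X) → drop m (applyUpTo f k) ≡ applyUpTo (λ i → f (m + i)) (k ∸ m)
drop-applyUpTo zero    k       f = refl
drop-applyUpTo (suc m) zero    f = refl
drop-applyUpTo (suc m) (suc k) f = drop-applyUpTo m k (λ i → f (suc i))

rank : Vertex → ℕ
rank (a , b) = C₂ (suc (a + b)) + b

vertexCount : ℕ → ℕ
vertexCount n = C₂ (suc (suc n))

rank-level : ∀ k → map rank (level k) ≡ applyUpTo (C₂ (suc k) +_) (suc k)
rank-level k = begin
  map rank (level k)                          ≡⟨ sym (map-∘ (upTo (suc k))) ⟩
  map (λ i → rank (k ∸ i , i)) (upTo (suc k)) ≡⟨ map-upTo _ (suc k) ⟩
  applyUpTo (λ i → rank (k ∸ i , i)) (suc k)  ≡⟨ applyUpTo-cong (suc k) on-level ⟩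
  applyUpTo (C₂ (suc k) +_) (suc k)           ∎
  where
  open ≡-Reasoning
  on-level : ∀ i → i < suc k → rank (k ∸ i , i) ≡ C₂ (suc k) + i
  on-level i i≤k = cong (λ s → C₂ (suc s) + i) (m∸n+n≡m (≤-pred i≤k))

rank-levels : ∀ k → map rank (concatMap level (upTo k)) ≡ upTo (C₂ (suc k))
rank-levels zero    = refl
rank-levels (suc k) = begin
  map rank (concatMap level (upTo (suc k)))
    ≡⟨ cong (λ ks → map rank (concatMap level ks)) (sym (upTo-∷ʳ k)) ⟩
  map rank (concatMap level (upTo k ++ k ∷ []))
    ≡⟨ cong (map rank) (concatMap-++ level (upTo k) (k ∷ [])) ⟩
  map rank (concatMap level (upTo k) ++ (level k ++ []))
    ≡⟨ map-++ rank (concatMap level (upTo k)) (level k ++ []) ⟩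
  map rank (concatMap level (upTo k)) ++ map rank (level k ++ [])
    ≡⟨ cong₂ _++_ (rank-levels k) (trans (cong (map rank) (++-identityʳ (level k))) (rank-level k)) ⟩
  upTo (C₂ (suc k)) ++ applyUpTo (C₂ (suc k) +_) (suc k)
    ≡⟨ sym (upTo-+ (C₂ (suc k)) (suc k)) ⟩
  upTo (C₂ (suc k) + suc k)
    ≡⟨ cong upTo (+-comm (C₂ (suc k)) (suc k)) ⟩
  upTo (C₂ (suc (suc k)))
    ∎
  where open ≡-Reasoning

rank-verts : ∀ n → map rank (verts n) ≡ upTo (vertexCount n)
rank-verts n = rank-levels (suc n)

length-verts : ∀ n → length (verts n) ≡ vertexCount n
length-verts n = trans (sym (length-map rank (verts n))) (trans (cong length (rank-verts n)) (length-upTo (vertexCount n)))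

∑-rank : ∀ n (h : ℕ → ℕ) → ∑ (verts n) (λ v → h (rank v)) ≡ ∑ (upTo (vertexCount n)) h
∑-rank n h = trans (sym (∑-map rank (verts n) h)) (cong (λ is → ∑ is h) (rank-verts n))

rank<vertexCount : ∀ n {v} → v ∈ verts n → rank v < vertexCount n
rank<vertexCount n {v} v∈V = ∈-upTo⁻ (subst (rank v ∈_) (rank-verts n) (∈-map⁺ rank v∈V))

C₂≤rank : ∀ v → C₂ (suc ∣ v ∣ᵥ) ≤ rank v
C₂≤rank (a , b) = m≤m+n (C₂ (suc (a + b))) b

∈-verts⁻ : ∀ n {v} → v ∈ verts n → ∣ v ∣ᵥ ≤ n
∈-verts⁻ n {v} v∈V = ≮⇒≥ λ n<∣v∣ →
  <⇒≱ (rank<vertexCount n v∈V) (≤-trans (C₂-mono-≤ (s≤s n<∣v∣)) (C₂≤rank v))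

∈-verts⁺ : ∀ {n} v → ∣ v ∣ᵥ ≤ n → v ∈ verts n
∈-verts⁺ {n} (a , b) a+b≤n = ∈-concatMap⁺ level (lose (∈-upTo⁺ (s≤s a+b≤n)) ab∈level)
  where
  ab∈level : (a , b) ∈ level (a + b)
  ab∈level = subst (λ x → (x , b) ∈ level (a + b)) (m+n∸n≡m a b)
                   (∈-map⁺ (λ i → (a + b ∸ i , i)) (∈-upTo⁺ (s≤s (m≤n+m b a))))

data Edge : Vertex → Vertex → Set where
  right : ∀ a b → Edge (a , b) (suc a , b)
  up    : ∀ a b → Edge (a , b) (a , suc b)
  diag  : ∀ a b → Edge (suc a , b) (a , suc b)

edge⇒Edge : ∀ {x y} → edge x y ≡ true → Edge x y
edge⇒Edge {a , b} {c , d} e with ∨-≡true ((c ≡ᵇ suc a) ∧ (d ≡ᵇ b)) e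
... | inj₁ e₁ with ≡ᵇ∧≡ᵇ c (suc a) d b e₁
...   | refl , refl = right a b
edge⇒Edge {a , b} {c , d} e | inj₂ e′ with ∨-≡true ((c ≡ᵇ a) ∧ (d ≡ᵇ suc b)) e′
... | inj₁ e₂ with ≡ᵇ∧≡ᵇ c a d (suc b) e₂
...   | refl , refl = up a b
edge⇒Edge {a , b} {c , d} e | inj₂ e′ | inj₂ e₃ with ≡ᵇ∧≡ᵇ a (suc c) d (suc b) e₃
...   | refl , refl = diag c b

adj⇒Edge : ∀ u v → adj u v ≡ true → Edge u v ⊎ Edge v u
adj⇒Edge u v uv with ∨-≡true (edge u v) uv
... | inj₁ e = inj₁ (edge⇒Edge e)
... | inj₂ e = inj₂ (edge⇒Edge e)

Edge⇒edge : ∀ {u v} → Edge u v → edge u v ≡ true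
Edge⇒edge (right a b) rewrite ≡ᵇ-refl a | ≡ᵇ-refl b = refl
Edge⇒edge (up a b)    rewrite ≡ᵇ-refl a | ≡ᵇ-refl b = ∨-zeroʳ _
Edge⇒edge (diag a b)  rewrite ≡ᵇ-refl a | ≡ᵇ-refl b =
  trans (cong ((a ≡ᵇ suc (suc a)) ∧ (suc b ≡ᵇ b) ∨_) (∨-zeroʳ _)) (∨-zeroʳ _)

Edge⇒adj : ∀ {u v} → Edge u v → adj u v ≡ true
Edge⇒adj {u} {v} uv rewrite Edge⇒edge uv = refl

adj-sym : ∀ u v → adj u v ≡ adj v u
adj-sym u v = ∨-comm (edge u v) (edge v u)

Edge-rank : ∀ {x y} → Edge x y → ∃ λ k → rank y ≡ rank x + k × k ≤ suc ∣ y ∣ᵥ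
Edge-rank (right a b) = suc (a + b) , shift (a + b) (C₂ (suc (a + b))) b , n≤1+n _
  where
  shift : ∀ s c b → (suc s + c) + b ≡ (c + b) + suc s
  shift = solve-∀
Edge-rank (up a b) rewrite +-suc a b = suc (suc (a + b)) , shift (a + b) (C₂ (suc (a + b))) b , ≤-refl
  where
  shift : ∀ s c b → (suc s + c) + suc b ≡ (c + b) + suc (suc s)
  shift = solve-∀
Edge-rank (diag a b) rewrite +-suc a b = 1 , shift (C₂ (suc (suc (a + b)))) b , s≤s z≤n
  where
  shift : ∀ c b → c + suc b ≡ (c + b) + 1
  shift = solve-∀

Edge-level : ∀ {x y} → Edge x y → ∣ x ∣ᵥ ≤ ∣ y ∣ᵥ × ∣ y ∣ᵥ ≤ suc ∣ x ∣ᵥ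
Edge-level (right a b) = n≤1+n _ , ≤-refl
Edge-level (up a b)   rewrite +-suc a b = n≤1+n _ , ≤-refl
Edge-level (diag a b) rewrite +-suc a b = ≤-refl , n≤1+n _

Edge-rank-≤ : ∀ {x y} → Edge x y → rank x ≤ rank y
Edge-rank-≤ xy with k , eq , _ ← Edge-rank xy = ≤-trans (m≤m+n _ k) (≤-reflexive (sym eq))

adj-rank-≤ : ∀ u v → adj u v ≡ true → rank v ≤ rank u + suc (suc ∣ u ∣ᵥ)
adj-rank-≤ u v uv with adj⇒Edge u v uv
... | inj₁ u→v with k , eq , k≤ ← Edge-rank u→v =
  ≤-trans (≤-reflexive eq) (+-monoʳ-≤ _ (≤-trans k≤ (s≤s (proj₂ (Edge-level u→v)))))
... | inj₂ v→u = ≤-trans (Edge-rank-≤ v→u) (m≤m+n _ _)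

adj-rank-≥ : ∀ u v → adj u v ≡ true → rank u ≤ rank v + suc ∣ u ∣ᵥ
adj-rank-≥ u v uv with adj⇒Edge u v uv
... | inj₁ u→v = ≤-trans (Edge-rank-≤ u→v) (m≤m+n _ _)
... | inj₂ v→u with k , eq , k≤ ← Edge-rank v→u = ≤-trans (≤-reflexive eq) (+-monoʳ-≤ _ k≤)

adj-level : ∀ u v → adj u v ≡ true → ∣ u ∣ᵥ ≤ suc ∣ v ∣ᵥ
adj-level u v uv with adj⇒Edge u v uv
... | inj₁ u→v = ≤-trans (proj₁ (Edge-level u→v)) (n≤1+n _)
... | inj₂ v→u = proj₂ (Edge-level v→u)

fromList-≡true : ∀ L v → fromList L v ≡ true → v ∈ L
fromList-≡true L (c , d) eq with (a , b) , ab∈L , ab≡cd ← any-≡true⁻ (λ u → eqV u (c , d)) L eq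
  with refl , refl ← ≡ᵇ∧≡ᵇ a c b d ab≡cd = ab∈L

χ : VSet → Vertex → ℕ
χ S v = ⟦ S v ⟧

χ≤θ : ∀ S v {m k} → (S v ≡ true → m ≤ k) → χ S v ≤ θ m k
χ≤θ S v m≤k with S v
... | true  = ≤-reflexive (sym (θ-≤ (m≤k refl)))
... | false = z≤n

card≡∑ : ∀ n S → card n S ≡ ∑ (verts n) (χ S)
card≡∑ n S = length-filter (verts n) S

boundary : ℕ → VSet → VSet
boundary n A v = not (A v) ∧ any (λ u → A u ∧ adj u v) (verts n)

card-nbhd : ∀ n S → card n (nbhd n S) ≡ card n S + card n (boundary n S)
card-nbhd n S = begin
  card n (nbhd n S)                                      ≡⟨ card≡∑ n (nbhd n S) ⟩
  ∑ (verts n) (χ (nbhd n S))                             ≡⟨ ∑-cong (verts n) (λ v _ → ⟦∨⟧ (S v) _) ⟩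
  ∑ (verts n) (λ v → χ S v + χ (boundary n S) v)         ≡⟨ ∑-+ (verts n) (χ S) (χ (boundary n S)) ⟩
  ∑ (verts n) (χ S) + ∑ (verts n) (χ (boundary n S))     ≡⟨ sym (cong₂ _+_ (card≡∑ n S) (card≡∑ n (boundary n S))) ⟩
  card n S + card n (boundary n S)                       ∎
  where
  open ≡-Reasoning
  ⟦∨⟧ : ∀ x y → ⟦ x ∨ y ⟧ ≡ ⟦ x ⟧ + ⟦ not x ∧ y ⟧
  ⟦∨⟧ true  y = refl
  ⟦∨⟧ false y = refl

card-complement : ∀ n S → card n S + card n (λ v → not (S v)) ≡ vertexCount n
card-complement n S = begin
  card n S + card n (λ v → not (S v))                    ≡⟨ cong₂ _+_ (card≡∑ n S) (card≡∑ n _) ⟩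
  ∑ (verts n) (χ S) + ∑ (verts n) (λ v → ⟦ not (S v) ⟧)  ≡⟨ sym (∑-+ (verts n) (χ S) (λ v → ⟦ not (S v) ⟧)) ⟩
  ∑ (verts n) (λ v → ⟦ S v ⟧ + ⟦ not (S v) ⟧)            ≡⟨ ∑-cong (verts n) (λ v _ → ⟦⟧+⟦not⟧ (S v)) ⟩
  ∑ (verts n) (λ _ → 1)                                  ≡⟨ ∑-const1 (verts n) ⟩
  length (verts n)                                       ≡⟨ length-verts n ⟩
  vertexCount n                                          ∎
  where
  open ≡-Reasoning
  ⟦⟧+⟦not⟧ : ∀ x → ⟦ x ⟧ + ⟦ not x ⟧ ≡ 1
  ⟦⟧+⟦not⟧ true  = refl
  ⟦⟧+⟦not⟧ false = refl

nbhd-≡true : ∀ n S v → nbhd n S v ≡ true →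
  S v ≡ true ⊎ ∃ λ u → u ∈ verts n × S u ≡ true × adj u v ≡ true
nbhd-≡true n S v eq with S v in Sv
... | true  = inj₁ refl
... | false with u , u∈V , Su∧uv ← any-≡true⁻ (λ u → S u ∧ adj u v) (verts n) eq =
  inj₂ (u , u∈V , ∧-conicalˡ _ _ Su∧uv , ∧-conicalʳ _ _ Su∧uv)

boundary-intro : ∀ {n} S {u w} → S w ≡ false → u ∈ verts n → S u ≡ true → adj u w ≡ true → boundary n S w ≡ true
boundary-intro S {u} {w} Sw u∈V Su uw rewrite Sw =
  any-≡true⁺ (λ u′ → S u′ ∧ adj u′ w) u∈V (subst (λ b → b ∧ adj u w ≡ true) (sym Su) uw)

rank-take : ∀ n m → map rank (take m (verts n)) ≡ upTo (m ⊓ vertexCount n)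
rank-take n m = begin
  map rank (take m (verts n))    ≡⟨ sym (take-map m (verts n)) ⟩
  take m (map rank (verts n))    ≡⟨ cong (take m) (rank-verts n) ⟩
  take m (upTo (vertexCount n))  ≡⟨ take-applyUpTo m (vertexCount n) (λ i → i) ⟩
  upTo (m ⊓ vertexCount n)       ∎
  where open ≡-Reasoning

rank-drop : ∀ n t → map rank (drop t (verts n)) ≡ applyUpTo (t +_) (vertexCount n ∸ t)
rank-drop n t = begin
  map rank (drop t (verts n))    ≡⟨ sym (drop-map t (verts n)) ⟩
  drop t (map rank (verts n))    ≡⟨ cong (drop t) (rank-verts n) ⟩
  drop t (upTo (vertexCount n))  ≡⟨ drop-applyUpTo t (vertexCount n) (λ i → i) ⟩
  applyUpTo (t +_) (vertexCount n ∸ t) ∎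
  where open ≡-Reasoning

∈-take-verts⇒rank< : ∀ n {m v} → v ∈ take m (verts n) → rank v < m
∈-take-verts⇒rank< n {m} {v} v∈ =
  ≤-trans (∈-upTo⁻ (subst (rank v ∈_) (rank-take n m) (∈-map⁺ rank v∈))) (m⊓n≤m m (vertexCount n))

∈-drop-verts⇒rank≥ : ∀ n {t v} → v ∈ drop t (verts n) → t ≤ rank v
∈-drop-verts⇒rank≥ n {t} {v} v∈
  with i , _ , eq ← ∈-applyUpTo⁻ (t +_) (subst (rank v ∈_) (rank-drop n t) (∈-map⁺ rank v∈))
  = subst (t ≤_) (sym eq) (m≤m+n t i)

card-≤-rank< : ∀ n S M → (∀ v → v ∈ verts n → S v ≡ true → rank v < M) → card n S ≤ M
card-≤-rank< n S M bound = begin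
  card n S                                             ≡⟨ card≡∑ n S ⟩
  ∑ (verts n) (χ S)                                    ≤⟨ ∑-mono-≤ (verts n) (λ v v∈V → χ≤θ S v (bound v v∈V)) ⟩
  ∑ (verts n) (λ v → θ (suc (rank v)) M)               ≡⟨ ∑-rank n (λ i → θ (suc i) M) ⟩
  ∑ (upTo (vertexCount n)) (λ i → θ (suc i) M)         ≤⟨ ∑-θ-below (vertexCount n) M ⟩
  M                                                    ∎
  where open ≤-Reasoning

card-≤-rank≥ : ∀ n S y → (∀ v → v ∈ verts n → S v ≡ true → y ≤ rank v) → card n S ≤ vertexCount n ∸ y
card-≤-rank≥ n S y bound = begin
  card n S                                             ≡⟨ card≡∑ n S ⟩
  ∑ (verts n) (χ S)                                    ≤⟨ ∑-mono-≤ (verts n) (λ v v∈V → χ≤θ S v (bound v v∈V)) ⟩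
  ∑ (verts n) (λ v → θ y (rank v))                     ≡⟨ ∑-rank n (θ y) ⟩
  ∑ (upTo (vertexCount n)) (θ y)                       ≤⟨ ∑-θ-above (vertexCount n) y ⟩
  vertexCount n ∸ y                                    ∎
  where open ≤-Reasoning

Path : (ℕ → Vertex) → Set
Path ℓ = ∀ i → adj (ℓ i) (ℓ (suc i)) ≡ true

module _ {n : ℕ} (S : VSet) where

  exit-boundary : ∀ k (ℓ : ℕ → Vertex) → Path ℓ → (∀ i → i ≤ k → ℓ i ∈ verts n) →
    S (ℓ 0) ≡ true → S (ℓ k) ≡ false → ∃ λ i → 0 < i × ℓ i ∈ verts n × boundary n S (ℓ i) ≡ true
  exit-boundary zero    ℓ path ℓ∈V first last with () ← trans (sym first) last
  exit-boundary (suc k) ℓ path ℓ∈V first last with S (ℓ 1) in second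
  ... | false = 1 , s≤s z≤n , ℓ∈V 1 (s≤s z≤n) , boundary-intro {n} S second (ℓ∈V 0 z≤n) first (path 0)
  ... | true
    with i , _ , ℓi∈V , ∂ℓi ← exit-boundary k (λ i → ℓ (suc i)) (λ i → path (suc i))
                                (λ i i≤k → ℓ∈V (suc i) (s≤s i≤k)) second last
    = suc i , s≤s z≤n , ℓi∈V , ∂ℓi

  entry-boundary : ∀ k (ℓ : ℕ → Vertex) → Path ℓ → (∀ i → i ≤ k → ℓ i ∈ verts n) →
    S (ℓ 0) ≡ false → S (ℓ k) ≡ true → ∃ λ i → ℓ i ∈ verts n × boundary n S (ℓ i) ≡ true
  entry-boundary zero    ℓ path ℓ∈V first last with () ← trans (sym first) last
  entry-boundary (suc k) ℓ path ℓ∈V first last with S (ℓ 1) in second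
  ... | true  = 0 , ℓ∈V 0 z≤n ,
    boundary-intro {n} S first (ℓ∈V 1 (s≤s z≤n)) second (trans (adj-sym (ℓ 1) (ℓ 0)) (path 0))
  ... | false
    with i , ℓi∈V , ∂ℓi ← entry-boundary k (λ i → ℓ (suc i)) (λ i → path (suc i))
                            (λ i i≤k → ℓ∈V (suc i) (s≤s i≤k)) second last
    = suc i , ℓi∈V , ∂ℓi

record Ray (x : Vertex) : Set where
  field
    point    : ℕ → Vertex
    path     : Path point
    on-level : ∀ i → ∣ point i ∣ᵥ ≡ i + ∣ x ∣ᵥ

rightward : ∀ x → Ray x
rightward (a , b) = record
  { point    = λ i → (i + a , b)
  ; path     = λ i → Edge⇒adj (right (i + a) b)
  ; on-level = λ i → +-assoc i a b
  }

upward : ∀ x → Ray x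
upward (a , b) = record
  { point    = λ i → (a , i + b)
  ; path     = λ i → Edge⇒adj (up a (i + b))
  ; on-level = λ i → x∙yz≈y∙xz a i b
  }

TopValued : ℕ → VSet → Bool → Set
TopValued n S β = ∀ x → x ∈ verts n → ∣ x ∣ᵥ ≡ n → S x ≡ β

module _ {n : ℕ} {x : Vertex} (x∈V : x ∈ verts n) (ρ : Ray x) where

  open Ray ρ

  ray-∈-verts : ∀ i → i ≤ n ∸ ∣ x ∣ᵥ → point i ∈ verts n
  ray-∈-verts i i≤ = ∈-verts⁺ (point i) (begin
    ∣ point i ∣ᵥ         ≡⟨ on-level i ⟩
    i + ∣ x ∣ᵥ           ≤⟨ +-monoˡ-≤ ∣ x ∣ᵥ i≤ ⟩
    n ∸ ∣ x ∣ᵥ + ∣ x ∣ᵥ  ≡⟨ m∸n+n≡m (∈-verts⁻ n x∈V) ⟩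
    n                    ∎)
    where open ≤-Reasoning

  ray-top : ∣ point (n ∸ ∣ x ∣ᵥ) ∣ᵥ ≡ n
  ray-top = trans (on-level (n ∸ ∣ x ∣ᵥ)) (m∸n+n≡m (∈-verts⁻ n x∈V))

  ray-exit : ∀ S → TopValued n S false → S (point 0) ≡ true →
    ∃ λ i → 0 < i × point i ∈ verts n × boundary n S (point i) ≡ true
  ray-exit S top first =
    exit-boundary {n} S (n ∸ ∣ x ∣ᵥ) point path ray-∈-verts first (top _ (ray-∈-verts _ ≤-refl) ray-top)

  ray-entry : ∀ S → TopValued n S true → S (point 0) ≡ false →
    ∃ λ i → point i ∈ verts n × boundary n S (point i) ≡ true
  ray-entry S top first =
    entry-boundary {n} S (n ∸ ∣ x ∣ᵥ) point path ray-∈-verts first (top _ (ray-∈-verts _ ≤-refl) ray-top)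

δ-pair-case : ∀ (v : Vertex) a b → v ≡ (a , b) ⊎ (∀ k → δ (proj₁ v) a * (δ (proj₂ v) b * k) ≡ 0)
δ-pair-case (x , y) a b with δ-case x a | δ-case y b
... | inj₁ refl | inj₁ refl = inj₁ refl
... | inj₁ _    | inj₂ δy≡0 = inj₂ (λ k → trans (cong (λ d → δ x a * (d * k)) δy≡0) (*-zeroʳ (δ x a)))
... | inj₂ δx≡0 | _         = inj₂ (λ k → cong (_* _) δx≡0)

δ-at : ∀ a b k → δ a a * (δ b b * k) ≡ k
δ-at a b k rewrite δ-refl a | δ-refl b = trans (+-identityʳ _) (+-identityʳ k)

module _ (n : ℕ) where

  row : (Vertex → ℕ) → ℕ → ℕ
  row w b = ∑ (verts n) (λ v → δ (proj₂ v) b * w v)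

  rowsFrom : (Vertex → ℕ) → ℕ → ℕ
  rowsFrom w b = ∑ (verts n) (λ v → θ b (proj₂ v) * w v)

  rowsFrom-split : ∀ w b → rowsFrom w b ≡ row w b + rowsFrom w (suc b)
  rowsFrom-split w b = begin
    rowsFrom w b                                                          ≡⟨ ∑-cong (verts n) (λ v _ → split v) ⟩
    ∑ (verts n) (λ v → δ (proj₂ v) b * w v + θ (suc b) (proj₂ v) * w v)  ≡⟨ ∑-+ (verts n) (λ v → δ (proj₂ v) b * w v) _ ⟩
    row w b + rowsFrom w (suc b)                                          ∎
    where
    open ≡-Reasoning
    split : ∀ v → θ b (proj₂ v) * w v ≡ δ (proj₂ v) b * w v + θ (suc b) (proj₂ v) * w v
    split v = trans (cong (_* w v) (θ-split b (proj₂ v))) (*-distribʳ-+ (w v) (δ (proj₂ v) b) (θ (suc b) (proj₂ v)))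

  rowsFrom-vanish : ∀ w b → n < b → rowsFrom w b ≡ 0
  rowsFrom-vanish w b n<b = ∑-zero (verts n) λ v@(x , y) v∈V →
    cong (_* w v) (θ-> (≤-<-trans (≤-trans (m≤n+m y x) (∈-verts⁻ n v∈V)) n<b))

  rowsFrom-zero : ∀ w → rowsFrom w 0 ≡ ∑ (verts n) w
  rowsFrom-zero w = ∑-cong (verts n) (λ v _ → +-identityʳ (w v))

  row-positive⁻ : ∀ S b → 1 ≤ row (χ S) b → ∃ λ a → (a , b) ∈ verts n × S (a , b) ≡ true
  row-positive⁻ S b pos with (a , y) , v∈V , 1≤term ← ∑-positive (verts n) _ pos with δ-case y b
  ... | inj₂ δ≡0 = contradiction (subst (λ d → 1 ≤ d * χ S (a , y)) δ≡0 1≤term) λ ()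
  ... | inj₁ refl with S (a , y) in Sv
  ...   | true  = a , v∈V , Sv
  ...   | false = contradiction (subst (1 ≤_) (*-zeroʳ (δ y y)) 1≤term) λ ()

  row-positive⁺ : ∀ S {a b} → (a , b) ∈ verts n → S (a , b) ≡ true → 1 ≤ row (χ S) b
  row-positive⁺ S {a} {b} v∈V Sv = ≤-trans (≤-reflexive (sym eq)) (∈⇒≤∑ (λ v → δ (proj₂ v) b * χ S v) v∈V)
    where
    eq : δ b b * χ S (a , b) ≡ 1
    eq rewrite δ-refl b | Sv = refl

  column : (Vertex → ℕ) → ℕ → ℕ
  column w a = ∑ (verts n) (λ v → δ (proj₁ v) a * w v)

  ∑-columns : ∀ w → ∑ (verts n) w ≡ ∑ (upTo (suc n)) (column w)
  ∑-columns w = trans (∑-cong (verts n) (λ v v∈V → sym (column-sum v v∈V)))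
                      (∑-swap (verts n) (upTo (suc n)) (λ v a → δ (proj₁ v) a * w v))
    where
    column-sum : ∀ v → v ∈ verts n → ∑ (upTo (suc n)) (λ a → δ (proj₁ v) a * w v) ≡ w v
    column-sum v@(x , y) v∈V = trans (∑-cong (upTo (suc n)) (λ a _ → cong (_* w v) (δ-sym x a)))
      (∑-δ (λ _ → w v) (s≤s (≤-trans (m≤m+n x y) (∈-verts⁻ n v∈V))))

  column-point≤1 : ∀ S a b → column (λ v → δ (proj₂ v) b * χ S v) a ≤ 1
  column-point≤1 S a b = begin
    column (λ v → δ (proj₂ v) b * χ S v) a               ≤⟨ ∑-mono-≤ (verts n) (λ v _ → term≤ v) ⟩
    ∑ (verts n) (λ v → δ (rank v) (rank (a , b)))        ≡⟨ ∑-rank n (λ i → δ i (rank (a , b))) ⟩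
    ∑ (upTo (vertexCount n)) (λ i → δ i (rank (a , b)))  ≤⟨ ∑-δ≤1 (vertexCount n) (rank (a , b)) ⟩
    1                                                    ∎
    where
    open ≤-Reasoning
    term≤ : ∀ v → δ (proj₁ v) a * (δ (proj₂ v) b * χ S v) ≤ δ (rank v) (rank (a , b))
    term≤ v with δ-pair-case v a b
    ... | inj₁ refl = begin
      δ a a * (δ b b * χ S (a , b))  ≡⟨ δ-at a b (χ S (a , b)) ⟩
      χ S (a , b)                    ≤⟨ ⟦⟧≤1 (S (a , b)) ⟩
      1                              ≡⟨ sym (δ-refl (rank (a , b))) ⟩
      δ (rank (a , b)) (rank (a , b)) ∎
    ... | inj₂ vanishes = ≤-trans (≤-reflexive (vanishes (χ S v))) z≤n

  column-point≡0 : ∀ S a b → ((a , b) ∈ verts n → S (a , b) ≡ false) → column (λ v → δ (proj₂ v) b * χ S v) a ≡ 0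
  column-point≡0 S a b ∉S = ∑-zero (verts n) term≡0
    where
    term≡0 : ∀ v → v ∈ verts n → δ (proj₁ v) a * (δ (proj₂ v) b * χ S v) ≡ 0
    term≡0 v v∈V with δ-pair-case v a b
    ... | inj₁ refl = trans (δ-at a b (χ S v)) (cong ⟦_⟧ (∉S v∈V))
    ... | inj₂ vanishes = vanishes (χ S v)

  -- Each column meets row b in at most one vertex, so it suffices to compare column by column.
  column-injection : ∀ S (G : Vertex → ℕ) b →
    (∀ a → (a , b) ∈ verts n → S (a , b) ≡ true → ∃ λ c → (a , c) ∈ verts n × 1 ≤ G (a , c)) →
    row (χ S) b ≤ ∑ (verts n) G
  column-injection S G b inject = begin
    row (χ S) b                                              ≡⟨ ∑-columns (λ v → δ (proj₂ v) b * χ S v) ⟩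
    ∑ (upTo (suc n)) (column (λ v → δ (proj₂ v) b * χ S v))  ≤⟨ ∑-mono-≤ (upTo (suc n)) (λ a _ → column≤ a) ⟩
    ∑ (upTo (suc n)) (column G)                              ≡⟨ sym (∑-columns G) ⟩
    ∑ (verts n) G                                            ∎
    where
    open ≤-Reasoning
    column≤ : ∀ a → column (λ v → δ (proj₂ v) b * χ S v) a ≤ column G a
    column≤ a with a + b ≤? n
    ... | no a+b≰n = ≤-trans (≤-reflexive (column-point≡0 S a b (λ v∈V → contradiction (∈-verts⁻ n v∈V) a+b≰n))) z≤n
    ... | yes a+b≤n with S (a , b) in Sab
    ...   | false = ≤-trans (≤-reflexive (column-point≡0 S a b (λ _ → Sab))) z≤n
    ...   | true with c , ac∈V , 1≤G ← inject a (∈-verts⁺ (a , b) a+b≤n) Sab = begin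
      column (λ v → δ (proj₂ v) b * χ S v) a  ≤⟨ column-point≤1 S a b ⟩
      1                                       ≤⟨ 1≤G ⟩
      G (a , c)                               ≡⟨ sym (trans (cong (_* G (a , c)) (δ-refl a)) (+-identityʳ _)) ⟩
      δ a a * G (a , c)                       ≤⟨ ∈⇒≤∑ (λ v → δ (proj₁ v) a * G v) ac∈V ⟩
      column G a                              ∎

downward-induction : ∀ (P : ℕ → Set) n → (∀ b → n < b → P b) → (∀ b → P (suc b) → P b) → ∀ b → P b
downward-induction P n base step b = go (suc n) b (<-≤-trans (n<1+n n) (m≤n+m (suc n) b))
  where
  go : ∀ k b → n < b + k → P b
  go zero    b n<b = base b (subst (n <_) (+-identityʳ b) n<b)
  go (suc k) b n<  = step b (go k (suc b) (subst (n <_) (+-suc b k) n<))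

-- A nonempty row r b ≤ D (suc b) forces D b ≥ suc (D (suc b)), and is then absorbed by
-- C₂ (suc D′) = D′ + C₂ D′.
module _ (r e R D : ℕ → ℕ) (n : ℕ)
         (R-split : ∀ b → R b ≡ r b + R (suc b)) (D-split : ∀ b → D b ≡ e b + D (suc b))
         (R-vanish : ∀ b → n < b → R b ≡ 0) (r⇒e : ∀ b → 1 ≤ r b → 1 ≤ e b) where

  tail-≤-C₂ : (∀ b → r b ≤ D (suc b)) → ∀ b → R b ≤ C₂ (D b)
  tail-≤-C₂ r≤D = downward-induction (λ b → R b ≤ C₂ (D b)) n
    (λ b n<b → ≤-trans (≤-reflexive (R-vanish b n<b)) z≤n)
    (λ b R′≤ → subst₂ (λ R D → R ≤ C₂ D) (sym (R-split b)) (sym (D-split b)) (step (r b) (e b) R′≤ (r≤D b) (r⇒e b)))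
    where
    step : ∀ r e {R′ D′} → R′ ≤ C₂ D′ → r ≤ D′ → (1 ≤ r → 1 ≤ e) → r + R′ ≤ C₂ (e + D′)
    step zero    e {D′ = D′} R′≤ _  _   = ≤-trans R′≤ (C₂-mono-≤ (m≤n+m D′ e))
    step (suc r) e {D′ = D′} R′≤ r≤ r⇒e =
      ≤-trans (+-mono-≤ r≤ R′≤) (C₂-mono-≤ (+-monoˡ-≤ D′ (r⇒e (s≤s z≤n))))

  tail-≤-C₂-suc : (∀ b → r b ≤ D b) → ∀ b → R b ≤ C₂ (suc (D b))
  tail-≤-C₂-suc r≤D = downward-induction (λ b → R b ≤ C₂ (suc (D b))) n
    (λ b n<b → ≤-trans (≤-reflexive (R-vanish b n<b)) z≤n)
    (λ b R′≤ → subst₂ (λ R D → R ≤ C₂ (suc D)) (sym (R-split b)) (sym (D-split b))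
                 (step (r b) (e b) R′≤ (subst (r b ≤_) (D-split b) (r≤D b)) (r⇒e b)))
    where
    step : ∀ r e {R′ D′} → R′ ≤ C₂ (suc D′) → r ≤ e + D′ → (1 ≤ r → 1 ≤ e) →
           r + R′ ≤ C₂ (suc (e + D′))
    step zero    e {D′ = D′} R′≤ _  _   = ≤-trans R′≤ (C₂-mono-≤ (s≤s (m≤n+m D′ e)))
    step (suc r) e {D′ = D′} R′≤ r≤ r⇒e =
      +-mono-≤ r≤ (≤-trans R′≤ (C₂-mono-≤ (+-monoˡ-≤ D′ (r⇒e (s≤s z≤n)))))

nbhd-initSeg-rank< : ∀ n m d → m ≤ C₂ d → ∀ v → v ∈ verts n → nbhd n (initSeg n m) v ≡ true → rank v < m + d
nbhd-initSeg-rank< n m d m≤C₂d v _ Nv with nbhd-≡true n (initSeg n m) v Nv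
... | inj₁ Cv = ≤-trans (∈-take-verts⇒rank< n (fromList-≡true _ v Cv)) (m≤m+n m d)
... | inj₂ (u , _ , Cu , uv) = begin-strict
  rank v                     ≤⟨ adj-rank-≤ u v uv ⟩
  rank u + suc (suc ∣ u ∣ᵥ)  <⟨ +-mono-<-≤ rank-u<m (C₂-cancel-< C₂[1+∣u∣]<C₂d) ⟩
  m + d                      ∎
  where
  open ≤-Reasoning
  rank-u<m : rank u < m
  rank-u<m = ∈-take-verts⇒rank< n (fromList-≡true _ u Cu)
  C₂[1+∣u∣]<C₂d : C₂ (suc ∣ u ∣ᵥ) < C₂ d
  C₂[1+∣u∣]<C₂d = <-≤-trans (≤-<-trans (C₂≤rank u) rank-u<m) m≤C₂d

nbhd-finalSeg-rank≥ : ∀ n m d → length (verts n) ∸ m ≤ C₂ (suc d) →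
  ∀ v → v ∈ verts n → nbhd n (finalSeg n m) v ≡ true → (length (verts n) ∸ m) ∸ d ≤ rank v
nbhd-finalSeg-rank≥ n m d t≤C₂ v _ Nv with nbhd-≡true n (finalSeg n m) v Nv
... | inj₁ Fv = ≤-trans (m∸n≤m _ d) (∈-drop-verts⇒rank≥ n (fromList-≡true _ v Fv))
... | inj₂ (u , _ , Fu , uv) with suc ∣ u ∣ᵥ ≤? d
...   | yes near = m≤n+o⇒m∸n≤o t d (begin
  t                       ≤⟨ ∈-drop-verts⇒rank≥ n (fromList-≡true _ u Fu) ⟩
  rank u                  ≤⟨ adj-rank-≥ u v uv ⟩
  rank v + suc ∣ u ∣ᵥ     ≤⟨ +-monoʳ-≤ (rank v) near ⟩
  rank v + d              ≡⟨ +-comm (rank v) d ⟩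
  d + rank v              ∎)
  where
  open ≤-Reasoning
  t = length (verts n) ∸ m
...   | no  far = begin
  t ∸ d                   ≤⟨ ∸-monoˡ-≤ d t≤C₂ ⟩
  (d + C₂ d) ∸ d          ≡⟨ m+n∸m≡n d (C₂ d) ⟩
  C₂ d                    ≤⟨ C₂-mono-≤ (≤-trans (≤-pred (≰⇒> far)) (adj-level u v uv)) ⟩
  C₂ (suc ∣ v ∣ᵥ)         ≤⟨ C₂≤rank v ⟩
  rank v                  ∎
  where
  open ≤-Reasoning
  t = length (verts n) ∸ m

1≤θ*χ : ∀ {m k} S v → m ≤ k → S v ≡ true → 1 ≤ θ m k * χ S v
1≤θ*χ S v m≤k Sv rewrite θ-≤ m≤k | Sv = ≤-refl

module _ {n : ℕ} (A : VSet) where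

  card-≤-C₂-boundary : TopValued n A false → card n A ≤ C₂ (card n (boundary n A))
  card-≤-C₂-boundary top = begin
    card n A                  ≡⟨ trans (card≡∑ n A) (sym (rowsFrom-zero n (χ A))) ⟩
    rowsFrom n (χ A) 0        ≤⟨ tail-≤-C₂ (row n (χ A)) (row n (χ ∂A)) (rowsFrom n (χ A)) (rowsFrom n (χ ∂A)) n
                                   (rowsFrom-split n (χ A)) (rowsFrom-split n (χ ∂A)) (rowsFrom-vanish n (χ A))
                                   rows-exit column-bound 0 ⟩
    C₂ (rowsFrom n (χ ∂A) 0)  ≡⟨ cong C₂ (trans (rowsFrom-zero n (χ ∂A)) (sym (card≡∑ n ∂A))) ⟩
    C₂ (card n ∂A)            ∎
    where
    open ≤-Reasoning
    ∂A = boundary n A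
    rows-exit : ∀ b → 1 ≤ row n (χ A) b → 1 ≤ row n (χ ∂A) b
    rows-exit b nonempty
      with a , ab∈V , Aab ← row-positive⁻ n A b nonempty
      with i , _ , ∈V , ∂i ← ray-exit ab∈V (rightward (a , b)) A top Aab
      = row-positive⁺ n ∂A ∈V ∂i
    column-bound : ∀ b → row n (χ A) b ≤ rowsFrom n (χ ∂A) (suc b)
    column-bound b = column-injection n A (λ v → θ (suc b) (proj₂ v) * χ ∂A v) b λ a ab∈V Aab →
      let i , 0<i , ∈V , ∂i = ray-exit ab∈V (upward (a , b)) A top Aab
      in i + b , ∈V , 1≤θ*χ ∂A (a , i + b) (+-monoˡ-≤ b 0<i) ∂i

  card-complement-≤-C₂-boundary : TopValued n A true → card n (λ v → not (A v)) ≤ C₂ (suc (card n (boundary n A)))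
  card-complement-≤-C₂-boundary top = begin
    card n B                        ≡⟨ trans (card≡∑ n B) (sym (rowsFrom-zero n (χ B))) ⟩
    rowsFrom n (χ B) 0              ≤⟨ tail-≤-C₂-suc (row n (χ B)) (row n (χ ∂A)) (rowsFrom n (χ B)) (rowsFrom n (χ ∂A)) n
                                         (rowsFrom-split n (χ B)) (rowsFrom-split n (χ ∂A)) (rowsFrom-vanish n (χ B))
                                         rows-entry column-bound 0 ⟩
    C₂ (suc (rowsFrom n (χ ∂A) 0))  ≡⟨ cong (λ k → C₂ (suc k)) (trans (rowsFrom-zero n (χ ∂A)) (sym (card≡∑ n ∂A))) ⟩
    C₂ (suc (card n ∂A))            ∎
    where
    open ≤-Reasoning
    ∂A = boundary n A
    B : VSet
    B v = not (A v)
    B⇒¬A : ∀ v → B v ≡ true → A v ≡ false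
    B⇒¬A v Bv = trans (sym (not-involutive (A v))) (cong not Bv)
    rows-entry : ∀ b → 1 ≤ row n (χ B) b → 1 ≤ row n (χ ∂A) b
    rows-entry b nonempty
      with a , ab∈V , Bab ← row-positive⁻ n B b nonempty
      with i , ∈V , ∂i ← ray-entry ab∈V (rightward (a , b)) A top (B⇒¬A _ Bab)
      = row-positive⁺ n ∂A ∈V ∂i
    column-bound : ∀ b → row n (χ B) b ≤ rowsFrom n (χ ∂A) b
    column-bound b = column-injection n B (λ v → θ b (proj₂ v) * χ ∂A v) b λ a ab∈V Bab →
      let i , ∈V , ∂i = ray-entry ab∈V (upward (a , b)) A top (B⇒¬A _ Bab)
      in i + b , ∈V , 1≤θ*χ ∂A (a , i + b) (m≤n+m b i) ∂i

  card-nbhd-initSeg-≤ : TopValued n A false → card n (nbhd n (initSeg n (card n A))) ≤ card n (nbhd n A)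
  card-nbhd-initSeg-≤ top = begin
    card n (nbhd n (initSeg n m))  ≤⟨ card-≤-rank< n _ (m + d) (nbhd-initSeg-rank< n m d (card-≤-C₂-boundary top)) ⟩
    m + d                          ≡⟨ sym (card-nbhd n A) ⟩
    card n (nbhd n A)              ∎
    where
    open ≤-Reasoning
    m = card n A
    d = card n (boundary n A)

  card-nbhd-finalSeg-≤ : TopValued n A true → card n (nbhd n (finalSeg n (card n A))) ≤ card n (nbhd n A)
  card-nbhd-finalSeg-≤ top = begin
    card n (nbhd n (finalSeg n m))             ≤⟨ card-≤-rank≥ n _ (t ∸ d) (nbhd-finalSeg-rank≥ n m d t≤C₂) ⟩
    vertexCount n ∸ (t ∸ d)                    ≡⟨ cong (λ N → vertexCount n ∸ ((N ∸ m) ∸ d)) (length-verts n) ⟩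
    vertexCount n ∸ ((vertexCount n ∸ m) ∸ d)  ≡⟨ cong (vertexCount n ∸_) (∸-+-assoc (vertexCount n) m d) ⟩
    vertexCount n ∸ (vertexCount n ∸ (m + d))  ≤⟨ m∸[m∸n]≤n (vertexCount n) (m + d) ⟩
    m + d                                      ≡⟨ sym (card-nbhd n A) ⟩
    card n (nbhd n A)                          ∎
    where
    open ≤-Reasoning
    m = card n A
    d = card n (boundary n A)
    t = length (verts n) ∸ m
    t≤C₂ : t ≤ C₂ (suc d)
    t≤C₂ = begin
      length (verts n) ∸ m                ≡⟨ cong (_∸ m) (trans (length-verts n) (sym (card-complement n A))) ⟩
      (m + card n (λ v → not (A v))) ∸ m  ≡⟨ m+n∸m≡n m _ ⟩
      card n (λ v → not (A v))            ≤⟨ card-complement-≤-C₂-boundary top ⟩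
      C₂ (suc d)                          ∎

lemma2 : (n : ℕ) → 1 ≤ n → (A : VSet) →
    (((x : Vertex) → x ∈ verts n → ∣ x ∣ᵥ ≡ n → A x ≡ false) →
      card n (nbhd n A) ≥ card n (nbhd n (initSeg n (card n A))))
    × (((x : Vertex) → x ∈ verts n → ∣ x ∣ᵥ ≡ n → A x ≡ true) →
      card n (nbhd n A) ≥ card n (nbhd n (finalSeg n (card n A))))
lemma2 n _ A = card-nbhd-initSeg-≤ A , card-nbhd-finalSeg-≤ A
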